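{- For every $n\ge5$, the matching polytope $P_M(W_n)$ of the wheel graph $W_n$ is not Gorenstein.
   Context: The wheel graph $W_n$ has vertex set $\mathbb{Z}_{n-1}\sqcup\{v\}$ and edges $\{i,i+1\}$ and $\{i,v\}$ for $i\in\mathbb{Z}_{n-1}$. For a graph $G$ with edge set $E$, the matching polytope $P_M(G)\subset\mathbb{R}^E$ is the convex hull of the indicator vectors of all matchings of $G$. A lattice polytope $P\subset\mathbb{R}^d$ is reflexive if both $P$ and its polar dual $P^*=\{y:\langle x,y\rangle\ge -1\ \forall x\in P\}$ are lattice polytopes; $P$ is Gorenstein if there exist $k\in\mathbb{Z}_{>0}$ and $\alpha\in\mathbb{Z}^d$ with $kP-\alpha$ reflexive.
   Formalization: The matching polytope $P_M(W_n)$, its dilates $kP-\alpha$ and their polar duals are taken in ℚ^E rather than ℝ^E, with convex hulls formed from rational coefficients. -}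

module Defs where

open import Data.Nat as ℕ using (ℕ; zero; suc; _∸_)
open import Data.Integer as ℤ using (ℤ; +_)
open import Data.Rational using (ℚ; _/_; 0ℚ; 1ℚ; _+_; _*_; _-_; _≤_; -_)
open import Data.Fin using (Fin; zero; suc; toℕ; fromℕ<; splitAt)
open import Data.Nat.Properties using (_<?_)
open import Data.Bool using (Bool; true; false; if_then_else_)
open import Data.Product using (Σ; ∃; _×_; _,_; proj₁; proj₂)
open import Data.Sum using (_⊎_; inj₁; inj₂)
open import Data.Unit using (⊤; tt)
open import Relation.Nullary using (¬_; yes; no)
open import Relation.Binary.PropositionalEquality using (_≡_; _≢_)
open import Data.Vec.Functional using (foldr)

Pt : ℕ → Set
Pt d = Fin d → ℚ

Region : ℕ → Set₁
Region d = Pt d → Set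

Σℚ : ∀ {k} → (Fin k → ℚ) → ℚ
Σℚ = foldr _+_ 0ℚ

⟪_,_⟫ : ∀ {d} → Pt d → Pt d → ℚ
⟪ x , y ⟫ = Σℚ (λ i → x i * y i)

ℤ→ℚ : ℤ → ℚ
ℤ→ℚ z = z / 1

Conv : ∀ {d} → Region d → Region d
Conv {d} S x =
  Σ ℕ λ k → Σ (Fin k → Pt d) λ p → Σ (Fin k → ℚ) λ c →
    ((i : Fin k) → S (p i)) × ((i : Fin k) → 0ℚ ≤ c i) ×
    (Σℚ c ≡ 1ℚ) × ((j : Fin d) → x j ≡ Σℚ (λ i → c i * p i j))

_≐_ : ∀ {d} → Region d → Region d → Set
P ≐ Q = ∀ x → (P x → Q x) × (Q x → P x)

IsLatticePolytope : ∀ {d} → Region d → Set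
IsLatticePolytope {d} P =
  Σ ℕ λ k → Σ (Fin k → Fin d → ℤ) λ v →
    P ≐ Conv (λ x → Σ (Fin k) λ i → (j : Fin d) → x j ≡ ℤ→ℚ (v i j))

Polar : ∀ {d} → Region d → Region d
Polar P y = ∀ x → P x → - 1ℚ ≤ ⟪ x , y ⟫

IsReflexive : ∀ {d} → Region d → Set
IsReflexive P = IsLatticePolytope P × IsLatticePolytope (Polar P)

DilateShift : ∀ {d} → ℕ → (Fin d → ℤ) → Region d → Region d
DilateShift {d} k α P y =
  Σ (Pt d) λ x → P x × ((j : Fin d) → y j ≡ ℤ→ℚ (+ k) * x j - ℤ→ℚ (α j))

IsGorenstein : ∀ {d} → Region d → Set
IsGorenstein {d} P =
  Σ ℕ λ k → (0 ℕ.< k) × Σ (Fin d → ℤ) λ α → IsReflexive (DilateShift k α P)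

-- Graphs given by a vertex type V and edges Fin E → V × V (unordered pairs).

ShareVertex : ∀ {V : Set} → V × V → V × V → Set
ShareVertex (a , b) (c , d) = (a ≡ c) ⊎ (a ≡ d) ⊎ (b ≡ c) ⊎ (b ≡ d)

IsMatching : ∀ {V : Set} {E : ℕ} → (Fin E → V × V) → (Fin E → Bool) → Set
IsMatching {E = E} ends M =
  (e f : Fin E) → e ≢ f → M e ≡ true → M f ≡ true → ¬ ShareVertex (ends e) (ends f)

indicator : ∀ {E} → (Fin E → Bool) → Pt E
indicator M e = if M e then 1ℚ else 0ℚ

MatchingPolytope : ∀ {V : Set} {E : ℕ} → (Fin E → V × V) → Region E
MatchingPolytope {E = E} ends =
  Conv (λ x → Σ (Fin E → Bool) λ M → IsMatching ends M × ((e : Fin E) → x e ≡ indicator M e))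

cyc : ∀ {m} → Fin m → Fin m
cyc {suc m} i with suc (toℕ i) <? suc m
... | yes p = fromℕ< p
... | no _ = zero

-- Wheel W_n: vertices ℤ_{n-1} ⊔ {v} (v = inj₂ tt), edges: rim edges
-- {i,i+1} (first n-1 edge indices) and spokes {i,v} (last n-1 indices).
WheelV : ℕ → Set
WheelV n = Fin (n ∸ 1) ⊎ ⊤

WheelE : ℕ → ℕ
WheelE n = (n ∸ 1) ℕ.+ (n ∸ 1)

wheelEnds : (n : ℕ) → Fin (WheelE n) → WheelV n × WheelV n
wheelEnds n e with splitAt (n ∸ 1) e
... | inj₁ i = inj₁ i , inj₁ (cyc i)
... | inj₂ i = inj₁ i , inj₂ tt

{-# OPTIONS --safe #-}
-- A polytope contains no
-- ray, so a valid inequality b ≤ ⟪x, a⟫ of P with a ≠ 0 forces k b < ⟪α, a⟫; rescaling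
-- a into the polar and taking a lattice point of the polar on the same face then shows
-- that every face of kP − α lies on a hyperplane ⟪q, z⟫ = −1 with z integral.  For the
-- faces x_e = 0 of P_M(W_n), which contain 0 and all other unit vectors, this forces
-- α = 1.  The vertex inequality at the hub then gives k > n − 1 ≥ 4.  On the other hand
-- the face where the three edges at a rim vertex carry total weight 1 contains each of
-- these edges alone and, for every other edge f, a matching {f, g} with g among them;
-- so its integral normal is t on the three edges and 0 elsewhere, and (k − 3) t = −1
-- forces k ≤ 4.

module Submission where

open import Defs
open import Data.Nat using (ℕ; _≤_)
open import Relation.Nullary using (¬_)

open import Algebra.Bundles using (Ring)
open import Data.Bool.Base using (Bool; true; false; _∨_; if_then_else_)
import Data.Bool.Properties as Bool
open import Data.Empty using (⊥; ⊥-elim)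
open import Data.Fin.Base as Fin using (Fin; zero; suc; toℕ; fromℕ; _↑ˡ_; _↑ʳ_; splitAt; punchIn)
import Data.Fin.Properties as Fin
open import Data.Integer.Base as ℤ using (ℤ)
import Data.Integer.Properties as ℤ
open import Data.Nat.Base as ℕ using (zero; suc)
import Data.Nat.Coprimality as Coprime
import Data.Nat.Properties as ℕ
open import Data.Product using (Σ; ∃; _×_; _,_; proj₁; proj₂)
open import Data.Rational.Base as ℚ using (ℚ; 0ℚ; 1ℚ; _+_; _*_; _-_; -_; 1/_; ∣_∣; mkℚ)
import Data.Rational.Properties as ℚ
open import Data.Rational.Solver using (module +-*-Solver)
open import Data.Sum using (_⊎_; inj₁; inj₂)
open import Data.Sum.Properties using (inj₁-injective)
open import Data.Unit using (tt)
open import Function.Base using (_∘_)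
open import Function.Definitions using (Injective)
open import Relation.Binary.PropositionalEquality
open import Relation.Nullary using (Dec; yes; no; does)

open import Algebra.Properties.Semiring.Sum (Ring.semiring ℚ.+-*-ring)
  using (sum; sum-cong-≗; sum-replicate-zero; sum-remove; ∑-distrib-+; ∑-comm; *-distribˡ-sum; *-distribʳ-sum)
open +-*-Solver

variable
  d k : ℕ

neg-involutive : (p : ℚ) → - - p ≡ p
neg-involutive p = solve 1 (λ p → :- :- p := p) refl p

p≤q⇒0≤q-p : {p q : ℚ} → p ℚ.≤ q → 0ℚ ℚ.≤ q - p
p≤q⇒0≤q-p {p} {q} p≤q = subst (ℚ._≤ q - p) (ℚ.+-inverseʳ p) (ℚ.+-monoˡ-≤ (- p) p≤q)

p<q⇒0<q-p : {p q : ℚ} → p ℚ.< q → 0ℚ ℚ.< q - p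
p<q⇒0<q-p {p} {q} p<q = subst (ℚ._< q - p) (ℚ.+-inverseʳ p) (ℚ.+-monoˡ-< (- p) p<q)

p-q≤r⇒p≤q+r : {p q r : ℚ} → p - q ℚ.≤ r → p ℚ.≤ q + r
p-q≤r⇒p≤q+r {p} {q} {r} p-q≤r =
  subst₂ ℚ._≤_ (solve 2 (λ p q → q :+ (p :- q) := p) refl p q) refl (ℚ.+-monoʳ-≤ q p-q≤r)

p<p+1 : ∀ p → p ℚ.< p + 1ℚ
p<p+1 p = subst (ℚ._< p + 1ℚ) (ℚ.+-identityʳ p) (ℚ.+-monoʳ-< p (ℚ.positive⁻¹ 1ℚ))

p≤∣p∣ : (p : ℚ) → p ℚ.≤ ∣ p ∣
p≤∣p∣ p with ℚ.≤-total 0ℚ p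
... | inj₁ 0≤p = ℚ.≤-reflexive (sym (ℚ.0≤p⇒∣p∣≡p 0≤p))
... | inj₂ p≤0 = ℚ.≤-trans p≤0 (ℚ.0≤∣p∣ p)

ℤ→ℚ≡mkℚ : (z : ℤ) → ℤ→ℚ z ≡ mkℚ z 0 (Coprime.sym (Coprime.1-coprimeTo ℤ.∣ z ∣))
ℤ→ℚ≡mkℚ (ℤ.+ n) = ℚ.normalize-coprime (Coprime.sym (Coprime.1-coprimeTo n))
ℤ→ℚ≡mkℚ ℤ.-[1+ n ] = cong -_ (ℚ.normalize-coprime (Coprime.sym (Coprime.1-coprimeTo (suc n))))

ℤ→ℚ-mono-≤ : {a b : ℤ} → a ℤ.≤ b → ℤ→ℚ a ℚ.≤ ℤ→ℚ b
ℤ→ℚ-mono-≤ {a} {b} a≤b rewrite ℤ→ℚ≡mkℚ a | ℤ→ℚ≡mkℚ b =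
  ℚ.*≤* (subst₂ ℤ._≤_ (sym (ℤ.*-identityʳ a)) (sym (ℤ.*-identityʳ b)) a≤b)

ℤ→ℚ-neg : (z : ℤ) → ℤ→ℚ (ℤ.- z) ≡ - ℤ→ℚ z
ℤ→ℚ-neg (ℤ.+ zero) = refl
ℤ→ℚ-neg (ℤ.+ suc n) = refl
ℤ→ℚ-neg ℤ.-[1+ n ] = sym (neg-involutive (ℤ→ℚ (ℤ.+ suc n)))

ℤ→ℚ-discrete : (m z : ℤ) → ℤ→ℚ z ℚ.≤ ℤ→ℚ m ⊎ ℤ→ℚ (ℤ.suc m) ℚ.≤ ℤ→ℚ z
ℤ→ℚ-discrete m z with z ℤ.≤? m
... | yes z≤m = inj₁ (ℤ→ℚ-mono-≤ z≤m)
... | no z≰m = inj₂ (ℤ→ℚ-mono-≤ (ℤ.i<j⇒suc[i]≤j (ℤ.≰⇒> z≰m)))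

ℤ→ℚ-pos⇒≥1 : (z : ℤ) → 0ℚ ℚ.< ℤ→ℚ z → 1ℚ ℚ.≤ ℤ→ℚ z
ℤ→ℚ-pos⇒≥1 z 0<z with ℤ→ℚ-discrete (ℤ.+ 0) z
... | inj₁ z≤0 = ⊥-elim (ℚ.<-irrefl refl (ℚ.<-≤-trans 0<z z≤0))
... | inj₂ 1≤z = 1≤z

*ℤ→ℚ≡1⇒≤1 : {a : ℚ} (z : ℤ) → 0ℚ ℚ.≤ a → a * ℤ→ℚ z ≡ 1ℚ → a ℚ.≤ 1ℚ
*ℤ→ℚ≡1⇒≤1 {a} z 0≤a az≡1 with ℤ→ℚ-discrete (ℤ.+ 0) z
... | inj₁ z≤0 = ⊥-elim (ℚ.<-irrefl refl (ℚ.<-≤-trans (ℚ.positive⁻¹ 1ℚ) (begin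
  1ℚ            ≡⟨ az≡1 ⟨
  a * ℤ→ℚ z     ≤⟨ ℚ.*-monoˡ-≤-nonNeg a {{ℚ.nonNegative 0≤a}} z≤0 ⟩
  a * 0ℚ        ≡⟨ ℚ.*-zeroʳ a ⟩
  0ℚ            ∎)))
  where open ℚ.≤-Reasoning
... | inj₂ 1≤z = begin
  a             ≡⟨ ℚ.*-identityʳ a ⟨
  a * 1ℚ        ≤⟨ ℚ.*-monoˡ-≤-nonNeg a {{ℚ.nonNegative 0≤a}} 1≤z ⟩
  a * ℤ→ℚ z     ≡⟨ az≡1 ⟩
  1ℚ            ∎
  where open ℚ.≤-Reasoning

*ℤ→ℚ≡-1⇒≤1 : {a : ℚ} (z : ℤ) → 0ℚ ℚ.≤ a → a * ℤ→ℚ z ≡ - 1ℚ → a ℚ.≤ 1ℚ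
*ℤ→ℚ≡-1⇒≤1 {a} z 0≤a az≡-1 = *ℤ→ℚ≡1⇒≤1 (ℤ.- z) 0≤a (begin
  a * ℤ→ℚ (ℤ.- z)   ≡⟨ cong (a *_) (ℤ→ℚ-neg z) ⟩
  a * - ℤ→ℚ z       ≡⟨ ℚ.neg-distribʳ-* a (ℤ→ℚ z) ⟨
  - (a * ℤ→ℚ z)     ≡⟨ cong -_ az≡-1 ⟩
  - - 1ℚ            ≡⟨⟩
  1ℚ                ∎)
  where open ≡-Reasoning

sum-mono-≤ : {f g : Fin k → ℚ} → (∀ i → f i ℚ.≤ g i) → sum f ℚ.≤ sum g
sum-mono-≤ {zero} f≤g = ℚ.≤-refl
sum-mono-≤ {suc k} f≤g = ℚ.+-mono-≤ (f≤g zero) (sum-mono-≤ (f≤g ∘ suc))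

sum-mono-< : {f g : Fin k → ℚ} → (∀ j → f j ℚ.≤ g j) → ∀ i → f i ℚ.< g i → sum f ℚ.< sum g
sum-mono-< {suc k} {f} {g} f≤g i fᵢ<gᵢ = begin-strict
  sum f                       ≡⟨ sum-remove f ⟩
  f i + sum (f ∘ punchIn i)   <⟨ ℚ.+-mono-<-≤ fᵢ<gᵢ (sum-mono-≤ (f≤g ∘ punchIn i)) ⟩
  g i + sum (g ∘ punchIn i)   ≡⟨ sum-remove g ⟨
  sum g                       ∎
  where open ℚ.≤-Reasoning

sum-nonNeg : {f : Fin k → ℚ} → (∀ i → 0ℚ ℚ.≤ f i) → 0ℚ ℚ.≤ sum f
sum-nonNeg {k} {f} 0≤f = subst (ℚ._≤ sum f) (sum-replicate-zero k) (sum-mono-≤ 0≤f)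

term≤sum : {f : Fin k → ℚ} → (∀ i → 0ℚ ℚ.≤ f i) → ∀ i → f i ℚ.≤ sum f
term≤sum {suc k} {f} 0≤f i = begin
  f i                         ≡⟨ ℚ.+-identityʳ (f i) ⟨
  f i + 0ℚ                    ≤⟨ ℚ.+-monoʳ-≤ (f i) (sum-nonNeg (0≤f ∘ punchIn i)) ⟩
  f i + sum (f ∘ punchIn i)   ≡⟨ sum-remove f ⟨
  sum f                       ∎
  where open ℚ.≤-Reasoning

sum-pointMass : (f : Fin k → ℚ) (i : Fin k) → (∀ j → j ≢ i → f j ≡ 0ℚ) → sum f ≡ f i
sum-pointMass {suc k} f i f≡0 = begin
  sum f                       ≡⟨ sum-remove f ⟩
  f i + sum (f ∘ punchIn i)   ≡⟨ cong (f i +_) (sum-cong-≗ (λ j → f≡0 (punchIn i j) (Fin.punchInᵢ≢i i j))) ⟩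
  f i + sum {k} (λ _ → 0ℚ)    ≡⟨ cong (f i +_) (sum-replicate-zero k) ⟩
  f i + 0ℚ                    ≡⟨ ℚ.+-identityʳ (f i) ⟩
  f i                         ∎
  where open ≡-Reasoning

sum≡1⇒positive : (c : Fin k → ℚ) → sum c ≡ 1ℚ → ∃ λ i → 0ℚ ℚ.< c i
sum≡1⇒positive {k} c Σc≡1 with Fin.any? (λ i → 0ℚ ℚ.<? c i)
... | yes c>0 = c>0
... | no ∄c>0 = ⊥-elim (ℚ.<-irrefl refl (ℚ.<-≤-trans (ℚ.positive⁻¹ 1ℚ) (begin
  1ℚ                ≡⟨ Σc≡1 ⟨
  sum c             ≤⟨ sum-mono-≤ (λ i → ℚ.≮⇒≥ (λ c>0 → ∄c>0 (i , c>0))) ⟩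
  sum {k} (λ _ → 0ℚ)  ≡⟨ sum-replicate-zero k ⟩
  0ℚ                ∎)))
  where open ℚ.≤-Reasoning

weightedSum-const : (c : Fin k → ℚ) (b : ℚ) → sum c ≡ 1ℚ → sum (λ i → c i * b) ≡ b
weightedSum-const c b Σc≡1 = trans (sym (*-distribʳ-sum b c)) (trans (cong (_* b) Σc≡1) (ℚ.*-identityˡ b))

⟪⟫-congˡ : {x y : Pt d} → (∀ j → x j ≡ y j) → (w : Pt d) → ⟪ x , w ⟫ ≡ ⟪ y , w ⟫
⟪⟫-congˡ x≗y w = sum-cong-≗ (λ j → cong (_* w j) (x≗y j))

⟪⟫-congʳ : (a : Pt d) {x y : Pt d} → (∀ j → x j ≡ y j) → ⟪ a , x ⟫ ≡ ⟪ a , y ⟫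
⟪⟫-congʳ a x≗y = sum-cong-≗ (λ j → cong (a j *_) (x≗y j))

⟪⟫-comm : (x y : Pt d) → ⟪ x , y ⟫ ≡ ⟪ y , x ⟫
⟪⟫-comm x y = sum-cong-≗ (λ j → ℚ.*-comm (x j) (y j))

⟪⟫-scaleʳ : (t : ℚ) (x y : Pt d) → ⟪ x , (λ j → t * y j) ⟫ ≡ t * ⟪ x , y ⟫
⟪⟫-scaleʳ t x y = begin
  sum (λ j → x j * (t * y j))   ≡⟨ sum-cong-≗ (λ j → solve 3 (λ t a b → a :* (t :* b) := t :* (a :* b)) refl t (x j) (y j)) ⟩
  sum (λ j → t * (x j * y j))   ≡⟨ *-distribˡ-sum t (λ j → x j * y j) ⟨
  t * ⟪ x , y ⟫                 ∎
  where open ≡-Reasoning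

⟪⟫-negʳ : (x y : Pt d) → ⟪ x , (λ j → - y j) ⟫ ≡ - ⟪ x , y ⟫
⟪⟫-negʳ x y = begin
  ⟪ x , (λ j → - y j) ⟫            ≡⟨ sum-cong-≗ (λ j → cong (x j *_) (solve 1 (λ a → :- a := con (- 1ℚ) :* a) refl (y j))) ⟩
  ⟪ x , (λ j → - 1ℚ * y j) ⟫       ≡⟨ ⟪⟫-scaleʳ (- 1ℚ) x y ⟩
  - 1ℚ * ⟪ x , y ⟫                 ≡⟨ solve 1 (λ a → con (- 1ℚ) :* a := :- a) refl ⟪ x , y ⟫ ⟩
  - ⟪ x , y ⟫                      ∎
  where open ≡-Reasoning

⟪⟫-linearˡ : (s t : ℚ) (x y w : Pt d) → ⟪ (λ j → s * x j + t * y j) , w ⟫ ≡ s * ⟪ x , w ⟫ + t * ⟪ y , w ⟫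
⟪⟫-linearˡ s t x y w = begin
  ⟪ (λ j → s * x j + t * y j) , w ⟫
    ≡⟨ sum-cong-≗ (λ j → solve 5 (λ s t x y w → (s :* x :+ t :* y) :* w := s :* (x :* w) :+ t :* (y :* w))
                                 refl s t (x j) (y j) (w j)) ⟩
  sum (λ j → s * (x j * w j) + t * (y j * w j))
    ≡⟨ ∑-distrib-+ (λ j → s * (x j * w j)) (λ j → t * (y j * w j)) ⟩
  sum (λ j → s * (x j * w j)) + sum (λ j → t * (y j * w j))
    ≡⟨ cong₂ _+_ (*-distribˡ-sum s (λ j → x j * w j)) (*-distribˡ-sum t (λ j → y j * w j)) ⟨
  s * ⟪ x , w ⟫ + t * ⟪ y , w ⟫
    ∎
  where open ≡-Reasoning

⟪⟫-+ˡ : (x y w : Pt d) → ⟪ (λ j → x j + y j) , w ⟫ ≡ ⟪ x , w ⟫ + ⟪ y , w ⟫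
⟪⟫-+ˡ x y w = trans (sum-cong-≗ (λ j → ℚ.*-distribʳ-+ (w j) (x j) (y j))) (∑-distrib-+ (λ j → x j * w j) (λ j → y j * w j))

⟪⟫-zeroˡ : (w : Pt d) → ⟪ (λ _ → 0ℚ) , w ⟫ ≡ 0ℚ
⟪⟫-zeroˡ {d} w = trans (sum-cong-≗ (λ j → ℚ.*-zeroˡ (w j))) (sum-replicate-zero d)

⟪⟫-dilateShift : (t : ℚ) (x a y : Pt d) → ⟪ (λ j → t * x j - a j) , y ⟫ ≡ t * ⟪ x , y ⟫ - ⟪ a , y ⟫
⟪⟫-dilateShift t x a y = begin
  ⟪ (λ j → t * x j - a j) , y ⟫
    ≡⟨ sum-cong-≗ (λ j → cong (_* y j) (solve 3 (λ t x a → t :* x :- a := t :* x :+ con (- 1ℚ) :* a) refl t (x j) (a j))) ⟩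
  ⟪ (λ j → t * x j + - 1ℚ * a j) , y ⟫
    ≡⟨ ⟪⟫-linearˡ t (- 1ℚ) x a y ⟩
  t * ⟪ x , y ⟫ + - 1ℚ * ⟪ a , y ⟫
    ≡⟨ solve 3 (λ t u v → t :* u :+ con (- 1ℚ) :* v := t :* u :- v) refl t ⟪ x , y ⟫ ⟪ a , y ⟫ ⟩
  t * ⟪ x , y ⟫ - ⟪ a , y ⟫
    ∎
  where open ≡-Reasoning

⁅_⁆ : Fin d → Fin d → Bool
⁅ f ⁆ j = does (j Fin.≟ f)

_∪_ : (Fin d → Bool) → (Fin d → Bool) → Fin d → Bool
(B ∪ C) j = B j ∨ C j

⁅⁆-true : {f j : Fin d} → ⁅ f ⁆ j ≡ true → j ≡ f
⁅⁆-true {f = f} {j} j∈⁅f⁆ with j Fin.≟ f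
... | yes j≡f = j≡f

⁅⁆∪⁅⁆-true : {f g j : Fin d} → (⁅ f ⁆ ∪ ⁅ g ⁆) j ≡ true → j ≡ f ⊎ j ≡ g
⁅⁆∪⁅⁆-true {f = f} {g} {j} j∈⁅f⁆∪⁅g⁆ with j Fin.≟ f | j Fin.≟ g
... | yes j≡f | _ = inj₁ j≡f
... | no _ | yes j≡g = inj₂ j≡g

indicator-false : (B : Fin k → Bool) (i : Fin k) → B i ≢ true → indicator B i ≡ 0ℚ
indicator-false B i Bᵢ≢true with B i
... | true = ⊥-elim (Bᵢ≢true refl)
... | false = refl

sum-indicator≤1 : (B : Fin k → Bool) → (∀ i i′ → i ≢ i′ → B i ≡ true → B i′ ≡ true → ⊥) →
                  sum (indicator B) ℚ.≤ 1ℚ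
sum-indicator≤1 {k} B atMostOne with Fin.any? (λ i → B i Bool.≟ true)
... | yes (i , Bᵢ≡true) = ℚ.≤-reflexive (begin
  sum (indicator B)
    ≡⟨ sum-pointMass (indicator B) i (λ i′ i′≢i → indicator-false B i′ (atMostOne i i′ (i′≢i ∘ sym) Bᵢ≡true)) ⟩
  indicator B i
    ≡⟨ cong (λ b → if b then 1ℚ else 0ℚ) Bᵢ≡true ⟩
  1ℚ
    ∎)
  where open ≡-Reasoning
... | no ∄true = begin
  sum (indicator B)      ≡⟨ sum-cong-≗ (λ i → indicator-false B i (λ Bᵢ≡true → ∄true (i , Bᵢ≡true))) ⟩
  sum {k} (λ _ → 0ℚ)     ≡⟨ sum-replicate-zero k ⟩
  0ℚ                     ≤⟨ ℚ.nonNegative⁻¹ 1ℚ ⟩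
  1ℚ                     ∎
  where open ℚ.≤-Reasoning

δ : Fin d → Pt d
δ f = indicator ⁅ f ⁆

δ-diagonal : (f : Fin d) → δ f f ≡ 1ℚ
δ-diagonal f with f Fin.≟ f
... | yes _ = refl
... | no f≢f = ⊥-elim (f≢f refl)

δ-offDiagonal : {f j : Fin d} → j ≢ f → δ f j ≡ 0ℚ
δ-offDiagonal {f = f} {j} j≢f with j Fin.≟ f
... | yes j≡f = ⊥-elim (j≢f j≡f)
... | no _ = refl

indicator⁅⁆∪⁅⁆ : {f g : Fin d} → f ≢ g → ∀ j → indicator (⁅ f ⁆ ∪ ⁅ g ⁆) j ≡ δ f j + δ g j
indicator⁅⁆∪⁅⁆ {f = f} {g} f≢g j with j Fin.≟ f | j Fin.≟ g
... | yes refl | yes refl = ⊥-elim (f≢g refl)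
... | yes _    | no _     = sym (ℚ.+-identityʳ 1ℚ)
... | no _     | yes _    = sym (ℚ.+-identityˡ 1ℚ)
... | no _     | no _     = refl

⟪⟫-δʳ : (x : Pt d) (f : Fin d) → ⟪ x , δ f ⟫ ≡ x f
⟪⟫-δʳ x f = begin
  ⟪ x , δ f ⟫   ≡⟨ sum-pointMass (λ j → x j * δ f j) f
                     (λ j j≢f → trans (cong (x j *_) (δ-offDiagonal j≢f)) (ℚ.*-zeroʳ (x j))) ⟩
  x f * δ f f   ≡⟨ cong (x f *_) (δ-diagonal f) ⟩
  x f * 1ℚ      ≡⟨ ℚ.*-identityʳ (x f) ⟩
  x f           ∎
  where open ≡-Reasoning

⟪⟫-δˡ : (f : Fin d) (x : Pt d) → ⟪ δ f , x ⟫ ≡ x f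
⟪⟫-δˡ f x = trans (⟪⟫-comm (δ f) x) (⟪⟫-δʳ x f)

⟪⟫-δ+δˡ : (f g : Fin d) (w : Pt d) → ⟪ (λ j → δ f j + δ g j) , w ⟫ ≡ w f + w g
⟪⟫-δ+δˡ f g w = trans (⟪⟫-+ˡ (δ f) (δ g) w) (cong₂ _+_ (⟪⟫-δˡ f w) (⟪⟫-δˡ g w))

χ : (Fin k → Fin d) → Pt d
χ τ j = sum (λ i → δ (τ i) j)

⟪⟫-χʳ : (x : Pt d) (τ : Fin k → Fin d) → ⟪ x , χ τ ⟫ ≡ sum (λ i → x (τ i))
⟪⟫-χʳ x τ = begin
  sum (λ j → x j * sum (λ i → δ (τ i) j))   ≡⟨ sum-cong-≗ (λ j → *-distribˡ-sum (x j) (λ i → δ (τ i) j)) ⟩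
  sum (λ j → sum (λ i → x j * δ (τ i) j))   ≡⟨ ∑-comm (λ j i → x j * δ (τ i) j) ⟩
  sum (λ i → ⟪ x , δ (τ i) ⟫)               ≡⟨ sum-cong-≗ (λ i → ⟪⟫-δʳ x (τ i)) ⟩
  sum (λ i → x (τ i))                       ∎
  where open ≡-Reasoning

χ-image : {τ : Fin k → Fin d} → Injective _≡_ _≡_ τ → ∀ i → χ τ (τ i) ≡ 1ℚ
χ-image {τ = τ} τ-injective i =
  trans (sum-pointMass (λ l → δ (τ l) (τ i)) i (λ l l≢i → δ-offDiagonal (λ τi≡τl → l≢i (sym (τ-injective τi≡τl)))))
        (δ-diagonal (τ i))

χ-outside : {τ : Fin k → Fin d} {e : Fin d} → (∀ i → τ i ≢ e) → χ τ e ≡ 0ℚ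
χ-outside {k} τ≢e = trans (sum-cong-≗ (λ i → δ-offDiagonal (τ≢e i ∘ sym))) (sum-replicate-zero k)

≗-multipleOfχ : {τ : Fin k → Fin d} {w : Pt d} {t : ℚ} → Injective _≡_ _≡_ τ →
  (∀ i → w (τ i) ≡ t) → (∀ f → (∀ i → τ i ≢ f) → w f ≡ 0ℚ) → ∀ e → w e ≡ t * χ τ e
≗-multipleOfχ {τ = τ} {w} {t} τ-injective w∘τ≡t w-outside e = byMembership (Fin.any? (λ i → τ i Fin.≟ e))
  where
  open ≡-Reasoning
  byMembership : Dec (∃ λ i → τ i ≡ e) → w e ≡ t * χ τ e
  byMembership (yes (i , τᵢ≡e)) = subst (λ f → w f ≡ t * χ τ f) τᵢ≡e (begin
    w (τ i)            ≡⟨ w∘τ≡t i ⟩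
    t                  ≡⟨ ℚ.*-identityʳ t ⟨
    t * 1ℚ             ≡⟨ cong (t *_) (χ-image τ-injective i) ⟨
    t * χ τ (τ i)      ∎)
  byMembership (no e∉τ) = begin
    w e                ≡⟨ w-outside e τ≢e ⟩
    0ℚ                 ≡⟨ ℚ.*-zeroʳ t ⟨
    t * 0ℚ             ≡⟨ cong (t *_) (χ-outside τ≢e) ⟨
    t * χ τ e          ∎
    where
    τ≢e : ∀ i → τ i ≢ e
    τ≢e i τᵢ≡e = e∉τ (i , τᵢ≡e)

Conv-singleton : {S : Region d} {x : Pt d} → S x → Conv S x
Conv-singleton {x = x} Sx =
  1 , (λ _ → x) , (λ _ → 1ℚ) , (λ _ → Sx) , (λ _ → ℚ.nonNegative⁻¹ 1ℚ) , refl ,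
  (λ j → solve 1 (λ a → a := con 1ℚ :* a :+ con 0ℚ) refl (x j))

⟪⟫-convexCombination : (a x : Pt d) (c : Fin k → ℚ) (p : Fin k → Pt d) →
  (∀ j → x j ≡ sum (λ i → c i * p i j)) → ⟪ a , x ⟫ ≡ sum (λ i → c i * ⟪ a , p i ⟫)
⟪⟫-convexCombination a x c p x≡ = begin
  ⟪ a , x ⟫                                     ≡⟨ ⟪⟫-congʳ a x≡ ⟩
  sum (λ j → a j * sum (λ i → c i * p i j))     ≡⟨ sum-cong-≗ (λ j → *-distribˡ-sum (a j) (λ i → c i * p i j)) ⟩
  sum (λ j → sum (λ i → a j * (c i * p i j)))   ≡⟨ ∑-comm (λ j i → a j * (c i * p i j)) ⟩
  sum (λ i → sum (λ j → a j * (c i * p i j)))   ≡⟨ sum-cong-≗ (λ i → sum-cong-≗ (λ j →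
                                                     solve 3 (λ a c p → a :* (c :* p) := c :* (a :* p)) refl (a j) (c i) (p i j))) ⟩
  sum (λ i → sum (λ j → c i * (a j * p i j)))   ≡⟨ sum-cong-≗ (λ i → *-distribˡ-sum (c i) (λ j → a j * p i j)) ⟨
  sum (λ i → c i * ⟪ a , p i ⟫)                 ∎
  where open ≡-Reasoning

Conv-≤ : {S : Region d} {x : Pt d} (a : Pt d) (b : ℚ) → (∀ s → S s → ⟪ a , s ⟫ ℚ.≤ b) → Conv S x → ⟪ a , x ⟫ ℚ.≤ b
Conv-≤ {x = x} a b bound (k , p , c , Sp , c≥0 , Σc≡1 , x≡) = begin
  ⟪ a , x ⟫                       ≡⟨ ⟪⟫-convexCombination a x c p x≡ ⟩
  sum (λ i → c i * ⟪ a , p i ⟫)   ≤⟨ sum-mono-≤ (λ i → ℚ.*-monoˡ-≤-nonNeg (c i) {{ℚ.nonNegative (c≥0 i)}} (bound (p i) (Sp i))) ⟩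
  sum (λ i → c i * b)             ≡⟨ weightedSum-const c b Σc≡1 ⟩
  b                               ∎
  where open ℚ.≤-Reasoning

Conv-≥ : {S : Region d} {x : Pt d} (a : Pt d) (b : ℚ) → (∀ s → S s → b ℚ.≤ ⟪ a , s ⟫) → Conv S x → b ℚ.≤ ⟪ a , x ⟫
Conv-≥ {x = x} a b bound (k , p , c , Sp , c≥0 , Σc≡1 , x≡) = begin
  b                               ≡⟨ weightedSum-const c b Σc≡1 ⟨
  sum (λ i → c i * b)             ≤⟨ sum-mono-≤ (λ i → ℚ.*-monoˡ-≤-nonNeg (c i) {{ℚ.nonNegative (c≥0 i)}} (bound (p i) (Sp i))) ⟩
  sum (λ i → c i * ⟪ a , p i ⟫)   ≡⟨ ⟪⟫-convexCombination a x c p x≡ ⟨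
  ⟪ a , x ⟫                       ∎
  where open ℚ.≤-Reasoning

Conv-faceWitness : {S : Region d} {y : Pt d} → Conv S y → ∃ λ p → S p ×
  (∀ a b → (∀ s → S s → b ℚ.≤ ⟪ a , s ⟫) → ⟪ a , y ⟫ ≡ b → ⟪ a , p ⟫ ≡ b)
Conv-faceWitness {S = S} {y} (k , p , c , Sp , c≥0 , Σc≡1 , y≡) with sum≡1⇒positive c Σc≡1
... | i , cᵢ>0 = p i , Sp i , onFace⇒onFace
  where
  onFace⇒onFace : ∀ a b → (∀ s → S s → b ℚ.≤ ⟪ a , s ⟫) → ⟪ a , y ⟫ ≡ b → ⟪ a , p i ⟫ ≡ b
  onFace⇒onFace a b valid ⟪a,y⟫≡b = ℚ.≤-antisym (ℚ.≮⇒≥ (ℚ.<-irrefl (sym ⟪a,y⟫≡b) ∘ b<⟪a,y⟫)) (valid (p i) (Sp i))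
    where
    open ℚ.≤-Reasoning
    b<⟪a,y⟫ : b ℚ.< ⟪ a , p i ⟫ → b ℚ.< ⟪ a , y ⟫
    b<⟪a,y⟫ b<⟪a,pᵢ⟫ = begin-strict
      b                               ≡⟨ weightedSum-const c b Σc≡1 ⟨
      sum (λ l → c l * b)             <⟨ sum-mono-< (λ l → ℚ.*-monoˡ-≤-nonNeg (c l) {{ℚ.nonNegative (c≥0 l)}} (valid (p l) (Sp l)))
                                                    i (ℚ.*-monoʳ-<-pos (c i) {{ℚ.positive cᵢ>0}} b<⟪a,pᵢ⟫) ⟩
      sum (λ l → c l * ⟪ a , p l ⟫)   ≡⟨ ⟪⟫-convexCombination a y c p y≡ ⟨
      ⟪ a , y ⟫                       ∎

LatticePoints : {N : ℕ} → (Fin N → Fin d → ℤ) → Region d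
LatticePoints {N = N} v x = Σ (Fin N) λ l → ∀ j → x j ≡ ℤ→ℚ (v l j)

LatticePolytope-bounded : {L : Region d} → IsLatticePolytope L → (a : Pt d) → ∃ λ M → ∀ x → L x → ⟪ a , x ⟫ ℚ.≤ M
LatticePolytope-bounded {d} (N , v , L≐Conv) a = M , λ x Lx → Conv-≤ a M vertex≤M (proj₁ (L≐Conv x) Lx)
  where
  ⟪a,v⟫ : Fin N → ℚ
  ⟪a,v⟫ l = ⟪ a , (λ j → ℤ→ℚ (v l j)) ⟫
  M : ℚ
  M = sum (λ l → ∣ ⟪a,v⟫ l ∣)
  vertex≤M : ∀ s → LatticePoints v s → ⟪ a , s ⟫ ℚ.≤ M
  vertex≤M s (l , s≡vₗ) = begin
    ⟪ a , s ⟫       ≡⟨ ⟪⟫-congʳ a s≡vₗ ⟩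
    ⟪a,v⟫ l         ≤⟨ p≤∣p∣ (⟪a,v⟫ l) ⟩
    ∣ ⟪a,v⟫ l ∣     ≤⟨ term≤sum (λ l → ℚ.0≤∣p∣ (⟪a,v⟫ l)) l ⟩
    M               ∎
    where open ℚ.≤-Reasoning

LatticePolytope-noRay : {L : Region d} → IsLatticePolytope L → (ψ r : Pt d) → ⟪ ψ , r ⟫ ≡ 1ℚ →
  ¬ (∀ t → 0ℚ ℚ.≤ t → L (λ j → t * r j))
LatticePolytope-noRay isLattice ψ r ⟪ψ,r⟫≡1 ray = ℚ.<-irrefl refl t<t
  where
  open ℚ.≤-Reasoning
  M : ℚ
  M = proj₁ (LatticePolytope-bounded isLattice ψ)
  t : ℚ
  t = ∣ M ∣ + 1ℚ
  0≤t : 0ℚ ℚ.≤ t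
  0≤t = ℚ.≤-trans (ℚ.0≤∣p∣ M) (ℚ.<⇒≤ (p<p+1 ∣ M ∣))
  t<t : t ℚ.< t
  t<t = begin-strict
    t                           ≡⟨ ℚ.*-identityʳ t ⟨
    t * 1ℚ                      ≡⟨ cong (t *_) ⟪ψ,r⟫≡1 ⟨
    t * ⟪ ψ , r ⟫               ≡⟨ ⟪⟫-scaleʳ t ψ r ⟨
    ⟪ ψ , (λ j → t * r j) ⟫     ≤⟨ proj₂ (LatticePolytope-bounded isLattice ψ) _ (ray t 0≤t) ⟩
    M                           ≤⟨ p≤∣p∣ M ⟩
    ∣ M ∣                       <⟨ p<p+1 ∣ M ∣ ⟩
    t                           ∎

LatticePolytope-faceLatticePoint : {L : Region d} {y : Pt d} → IsLatticePolytope L → L y →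
  ∃ λ (z : Fin d → ℤ) →
    ∀ a b → (∀ s → L s → b ℚ.≤ ⟪ a , s ⟫) → ⟪ a , y ⟫ ≡ b → ⟪ a , (λ j → ℤ→ℚ (z j)) ⟫ ≡ b
LatticePolytope-faceLatticePoint {y = y} (N , v , L≐Conv) Ly =
  let p , (l , p≡vₗ) , onFace⇒onFace = Conv-faceWitness {S = LatticePoints v} (proj₁ (L≐Conv y) Ly) in
  v l , λ a b valid ⟪a,y⟫≡b →
    trans (sym (⟪⟫-congʳ a p≡vₗ)) (onFace⇒onFace a b (λ s Vs → valid s (proj₂ (L≐Conv s) (Conv-singleton Vs))) ⟪a,y⟫≡b)

module DilatedPolar {d : ℕ} (P : Region d) (k : ℕ) (α : Fin d → ℤ)
  (polar-lattice : IsLatticePolytope (Polar (DilateShift k α P))) where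

  K : ℚ
  K = ℤ→ℚ (ℤ.+ k)

  A : Pt d
  A j = ℤ→ℚ (α j)

  -- height x y = ⟪ k x − α , y ⟫, so the polar of kP − α is where height ≥ −1 on P.
  height : Pt d → Pt d → ℚ
  height x y = K * ⟪ x , y ⟫ - ⟪ A , y ⟫

  0≤K : 0ℚ ℚ.≤ K
  0≤K = ℤ→ℚ-mono-≤ {ℤ.+ 0} {ℤ.+ k} (ℤ.+≤+ ℕ.z≤n)

  Polar-intro : {y : Pt d} → (∀ x → P x → - 1ℚ ℚ.≤ height x y) → Polar (DilateShift k α P) y
  Polar-intro {y} bound q (x , Px , q≡) =
    subst (- 1ℚ ℚ.≤_) (sym (trans (⟪⟫-congˡ q≡ y) (⟪⟫-dilateShift K x A y))) (bound x Px)

  height-scaleʳ : (t : ℚ) (x y : Pt d) → height x (λ j → t * y j) ≡ t * height x y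
  height-scaleʳ t x y = begin
    K * ⟪ x , (λ j → t * y j) ⟫ - ⟪ A , (λ j → t * y j) ⟫
      ≡⟨ cong₂ (λ u v → K * u - v) (⟪⟫-scaleʳ t x y) (⟪⟫-scaleʳ t A y) ⟩
    K * (t * ⟪ x , y ⟫) - t * ⟪ A , y ⟫
      ≡⟨ solve 4 (λ K t u v → K :* (t :* u) :- t :* v := t :* (K :* u :- v)) refl K t ⟪ x , y ⟫ ⟪ A , y ⟫ ⟩
    t * height x y
      ∎
    where open ≡-Reasoning

  height-mono : {a x : Pt d} {b : ℚ} → b ℚ.≤ ⟪ x , a ⟫ → K * b - ⟪ A , a ⟫ ℚ.≤ height x a
  height-mono {a} b≤⟪x,a⟫ = ℚ.+-monoˡ-≤ (- ⟪ A , a ⟫) (ℚ.*-monoˡ-≤-nonNeg K {{ℚ.nonNegative 0≤K}} b≤⟪x,a⟫)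

  height-origin : (w : Pt d) → height (λ _ → 0ℚ) w ≡ - ⟪ A , w ⟫
  height-origin w = trans (cong (λ u → K * u - ⟪ A , w ⟫) (⟪⟫-zeroˡ w))
                          (solve 2 (λ K s → K :* con 0ℚ :- s := :- s) refl K ⟪ A , w ⟫)

  valid⇒Kb<⟪A,a⟫ : (a ψ : Pt d) (b : ℚ) → ⟪ ψ , a ⟫ ≡ 1ℚ → (∀ x → P x → b ℚ.≤ ⟪ x , a ⟫) →
                   K * b ℚ.< ⟪ A , a ⟫
  valid⇒Kb<⟪A,a⟫ a ψ b ⟪ψ,a⟫≡1 valid = ℚ.≰⇒> λ ⟪A,a⟫≤Kb →
    LatticePolytope-noRay polar-lattice ψ a ⟪ψ,a⟫≡1 λ t 0≤t → Polar-intro λ x Px → begin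
      - 1ℚ                          ≤⟨ ℚ.nonPositive⁻¹ (- 1ℚ) ⟩
      0ℚ                            ≡⟨ ℚ.*-zeroʳ t ⟨
      t * 0ℚ                        ≤⟨ ℚ.*-monoˡ-≤-nonNeg t {{ℚ.nonNegative 0≤t}}
                                         (ℚ.≤-trans (p≤q⇒0≤q-p ⟪A,a⟫≤Kb) (height-mono {a} {x} (valid x Px))) ⟩
      t * height x a                ≡⟨ height-scaleʳ t x a ⟨
      height x (λ j → t * a j)      ∎
    where open ℚ.≤-Reasoning

  valid⇒latticeNormal : (a : Pt d) (b : ℚ) → (∀ x → P x → b ℚ.≤ ⟪ x , a ⟫) → K * b ℚ.< ⟪ A , a ⟫ →
    ∃ λ (z : Fin d → ℤ) → ∀ x → P x → ⟪ x , a ⟫ ≡ b → height x (λ j → ℤ→ℚ (z j)) ≡ - 1ℚ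
  valid⇒latticeNormal a b valid Kb<⟪A,a⟫ =
    let z , onFace⇒onFace = LatticePolytope-faceLatticePoint polar-lattice y∈Polar in
    z , λ x Px ⟪x,a⟫≡b →
      trans (sym (⟪⟫-dilateShift K x A _))
            (onFace⇒onFace (λ j → K * x j - A j) (- 1ℚ) (λ s s∈Polar → s∈Polar _ (x , Px , λ _ → refl))
                           (trans (⟪⟫-dilateShift K x A y) (y-onFace x ⟪x,a⟫≡b)))
    where
    c : ℚ
    c = ⟪ A , a ⟫ - K * b
    instance
      c-positive : ℚ.Positive c
      c-positive = ℚ.positive (p<q⇒0<q-p Kb<⟪A,a⟫)
      c-nonZero : ℚ.NonZero c
      c-nonZero = ℚ.pos⇒nonZero c
    y : Pt d
    y j = 1/ c * a j
    c⁻¹[Kb-⟪A,a⟫]≡-1 : 1/ c * (K * b - ⟪ A , a ⟫) ≡ - 1ℚ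
    c⁻¹[Kb-⟪A,a⟫]≡-1 = begin
      1/ c * (K * b - ⟪ A , a ⟫)   ≡⟨ solve 3 (λ i u v → i :* (v :- u) := :- (i :* (u :- v))) refl (1/ c) ⟪ A , a ⟫ (K * b) ⟩
      - (1/ c * c)                 ≡⟨ cong -_ (ℚ.*-inverseˡ c) ⟩
      - 1ℚ                         ∎
      where open ≡-Reasoning
    y∈Polar : Polar (DilateShift k α P) y
    y∈Polar = Polar-intro λ x Px → begin
      - 1ℚ                         ≡⟨ c⁻¹[Kb-⟪A,a⟫]≡-1 ⟨
      1/ c * (K * b - ⟪ A , a ⟫)   ≤⟨ ℚ.*-monoˡ-≤-nonNeg (1/ c) {{ℚ.pos⇒nonNeg (1/ c) {{ℚ.1/pos⇒pos c}}}}
                                                          (height-mono {a} {x} (valid x Px)) ⟩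
      1/ c * height x a            ≡⟨ height-scaleʳ (1/ c) x a ⟨
      height x y                   ∎
      where open ℚ.≤-Reasoning
    y-onFace : ∀ x → ⟪ x , a ⟫ ≡ b → height x y ≡ - 1ℚ
    y-onFace x ⟪x,a⟫≡b = begin
      height x y                   ≡⟨ height-scaleʳ (1/ c) x a ⟩
      1/ c * height x a            ≡⟨ cong (λ u → 1/ c * (K * u - ⟪ A , a ⟫)) ⟪x,a⟫≡b ⟩
      1/ c * (K * b - ⟪ A , a ⟫)   ≡⟨ c⁻¹[Kb-⟪A,a⟫]≡-1 ⟩
      - 1ℚ                         ∎
      where open ≡-Reasoning

  module _ (k>0 : 0 ℕ.< k) where

    0<K : 0ℚ ℚ.< K
    0<K = ℚ.<-≤-trans (ℚ.positive⁻¹ 1ℚ) (ℤ→ℚ-mono-≤ {ℤ.+ 1} {ℤ.+ k} (ℤ.+≤+ k>0))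

    K*-cancel : {p q : ℚ} → K * p ≡ K * q → p ≡ q
    K*-cancel Kp≡Kq =
      ℚ.≤-antisym (ℚ.*-cancelˡ-≤-pos K (ℚ.≤-reflexive Kp≡Kq)) (ℚ.*-cancelˡ-≤-pos K (ℚ.≤-reflexive (sym Kp≡Kq)))
      where instance
        K-positive : ℚ.Positive K
        K-positive = ℚ.positive 0<K

    height-cancel : (x x′ w : Pt d) → height x w ≡ height x′ w → ⟪ x , w ⟫ ≡ ⟪ x′ , w ⟫
    height-cancel x x′ w hx≡hx′ = K*-cancel (begin
      K * ⟪ x , w ⟫                ≡⟨ solve 2 (λ u v → u := (u :- v) :+ v) refl (K * ⟪ x , w ⟫) ⟪ A , w ⟫ ⟩
      height x w + ⟪ A , w ⟫       ≡⟨ cong (_+ ⟪ A , w ⟫) hx≡hx′ ⟩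
      height x′ w + ⟪ A , w ⟫      ≡⟨ solve 2 (λ u v → (u :- v) :+ v := u) refl (K * ⟪ x′ , w ⟫) ⟪ A , w ⟫ ⟩
      K * ⟪ x′ , w ⟫               ∎)
      where open ≡-Reasoning

    height-δ-cancel : (f g : Fin d) (w : Pt d) → height (δ f) w ≡ height (δ g) w → w f ≡ w g
    height-δ-cancel f g w hf≡hg = begin
      w f               ≡⟨ ⟪⟫-δˡ f w ⟨
      ⟪ δ f , w ⟫       ≡⟨ height-cancel (δ f) (δ g) w hf≡hg ⟩
      ⟪ δ g , w ⟫       ≡⟨ ⟪⟫-δˡ g w ⟩
      w g               ∎
      where open ≡-Reasoning

    height-δ+δ-cancel : (f g : Fin d) (w : Pt d) → height (λ j → δ f j + δ g j) w ≡ height (δ g) w → w f ≡ 0ℚ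
    height-δ+δ-cancel f g w hfg≡hg = begin
      w f                    ≡⟨ solve 2 (λ p q → p := (p :+ q) :- q) refl (w f) (w g) ⟩
      (w f + w g) - w g      ≡⟨ cong (_- w g) (⟪⟫-δ+δˡ f g w) ⟨
      ⟪ δf+δg , w ⟫ - w g    ≡⟨ cong (_- w g) (trans (height-cancel δf+δg (δ g) w hfg≡hg) (⟪⟫-δˡ g w)) ⟩
      w g - w g              ≡⟨ ℚ.+-inverseʳ (w g) ⟩
      0ℚ                     ∎
      where
      open ≡-Reasoning
      δf+δg : Pt d
      δf+δg j = δ f j + δ g j

    faceNormal≗multipleOfχ : {c : ℕ} {τ : Fin (suc c) → Fin d} → Injective _≡_ _≡_ τ → (∀ i → P (δ (τ i))) →
      (∀ f → (∀ i → τ i ≢ f) → ∃ λ i → P (λ j → δ f j + δ (τ i) j)) →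
      (Z : Pt d) → (∀ x → P x → ⟪ x , χ τ ⟫ ≡ 1ℚ → height x Z ≡ - 1ℚ) → ∀ e → Z e ≡ Z (τ zero) * χ τ e
    faceNormal≗multipleOfχ {c} {τ} τ-injective Pδτ partner Z onFace =
      ≗-multipleOfχ τ-injective (λ i → height-δ-cancel (τ i) (τ zero) Z (trans (onFace-δ i) (sym (onFace-δ zero)))) Z-outside
      where
      onFace-δ : ∀ i → height (δ (τ i)) Z ≡ - 1ℚ
      onFace-δ i = onFace (δ (τ i)) (Pδτ i) (trans (⟪⟫-δˡ (τ i) (χ τ)) (χ-image τ-injective i))
      Z-outside : ∀ f → (∀ i → τ i ≢ f) → Z f ≡ 0ℚ
      Z-outside f f∉τ = height-δ+δ-cancel f (τ i) Z (trans (onFace _ P[δf+δτᵢ] ⟪δf+δτᵢ,χτ⟫≡1) (sym (onFace-δ i)))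
        where
        i : Fin (suc c)
        i = proj₁ (partner f f∉τ)
        P[δf+δτᵢ] : P (λ j → δ f j + δ (τ i) j)
        P[δf+δτᵢ] = proj₂ (partner f f∉τ)
        ⟪δf+δτᵢ,χτ⟫≡1 : ⟪ (λ j → δ f j + δ (τ i) j) , χ τ ⟫ ≡ 1ℚ
        ⟪δf+δτᵢ,χτ⟫≡1 = begin
          ⟪ (λ j → δ f j + δ (τ i) j) , χ τ ⟫   ≡⟨ ⟪⟫-δ+δˡ f (τ i) (χ τ) ⟩
          χ τ f + χ τ (τ i)                     ≡⟨ cong₂ _+_ (χ-outside f∉τ) (χ-image τ-injective i) ⟩
          0ℚ + 1ℚ                               ≡⟨ ℚ.+-identityˡ 1ℚ ⟩
          1ℚ                                    ∎
          where open ≡-Reasoning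

    α≡1 : P (λ _ → 0ℚ) → (∀ f → P (δ f)) → (∀ x → P x → ∀ e → 0ℚ ℚ.≤ x e) → ∀ e → A e ≡ 1ℚ
    α≡1 P0 Pδ P≥0 e = ℚ.≤-antisym Aₑ≤1 (ℤ→ℚ-pos⇒≥1 (α e) 0<Aₑ)
      where
      valid : ∀ x → P x → 0ℚ ℚ.≤ ⟪ x , δ e ⟫
      valid x Px = subst (0ℚ ℚ.≤_) (sym (⟪⟫-δʳ x e)) (P≥0 x Px e)
      gap : K * 0ℚ ℚ.< ⟪ A , δ e ⟫
      gap = valid⇒Kb<⟪A,a⟫ (δ e) (δ e) 0ℚ (trans (⟪⟫-δʳ (δ e) e) (δ-diagonal e)) valid
      0<Aₑ : 0ℚ ℚ.< A e
      0<Aₑ = subst₂ ℚ._<_ (ℚ.*-zeroʳ K) (⟪⟫-δʳ A e) gap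
      z : Fin d → ℤ
      z = proj₁ (valid⇒latticeNormal (δ e) 0ℚ valid gap)
      Z : Pt d
      Z j = ℤ→ℚ (z j)
      onFace : ∀ x → P x → ⟪ x , δ e ⟫ ≡ 0ℚ → height x Z ≡ - 1ℚ
      onFace = proj₂ (valid⇒latticeNormal (δ e) 0ℚ valid gap)
      height0 : height (λ _ → 0ℚ) Z ≡ - 1ℚ
      height0 = onFace (λ _ → 0ℚ) P0 (⟪⟫-zeroˡ (δ e))
      Z-offDiagonal : ∀ f → f ≢ e → Z f ≡ 0ℚ
      Z-offDiagonal f f≢e = begin
        Z f                     ≡⟨ ⟪⟫-δˡ f Z ⟨
        ⟪ δ f , Z ⟫             ≡⟨ height-cancel (δ f) (λ _ → 0ℚ) Z (trans (onFace (δ f) (Pδ f) ⟪δf,δe⟫≡0) (sym height0)) ⟩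
        ⟪ (λ _ → 0ℚ) , Z ⟫      ≡⟨ ⟪⟫-zeroˡ Z ⟩
        0ℚ                      ∎
        where
        open ≡-Reasoning
        ⟪δf,δe⟫≡0 : ⟪ δ f , δ e ⟫ ≡ 0ℚ
        ⟪δf,δe⟫≡0 = trans (⟪⟫-δˡ f (δ e)) (δ-offDiagonal f≢e)
      AₑZₑ≡1 : A e * Z e ≡ 1ℚ
      AₑZₑ≡1 = begin
        A e * Z e                     ≡⟨ sum-pointMass (λ j → A j * Z j) e
                                             (λ j j≢e → trans (cong (A j *_) (Z-offDiagonal j j≢e)) (ℚ.*-zeroʳ (A j))) ⟨
        ⟪ A , Z ⟫                     ≡⟨ neg-involutive ⟪ A , Z ⟫ ⟨
        - - ⟪ A , Z ⟫                 ≡⟨ cong -_ (height-origin Z) ⟨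
        - height (λ _ → 0ℚ) Z         ≡⟨ cong -_ height0 ⟩
        - - 1ℚ                        ≡⟨ neg-involutive 1ℚ ⟩
        1ℚ                            ∎
        where open ≡-Reasoning
      Aₑ≤1 : A e ℚ.≤ 1ℚ
      Aₑ≤1 = *ℤ→ℚ≡1⇒≤1 (z e) (ℚ.<⇒≤ 0<Aₑ) AₑZₑ≡1

  module _ {c : ℕ} {τ : Fin (suc c) → Fin d} (τ-injective : Injective _≡_ _≡_ τ)
           (χτ≤1 : ∀ x → P x → ⟪ x , χ τ ⟫ ℚ.≤ 1ℚ) where

    private
      σ : ℚ
      σ = sum (λ i → A (τ i))

      -χτ : Pt d
      -χτ j = - χ τ j

      -χτ≥-1 : ∀ x → P x → - 1ℚ ℚ.≤ ⟪ x , -χτ ⟫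
      -χτ≥-1 x Px = subst (- 1ℚ ℚ.≤_) (sym (⟪⟫-negʳ x (χ τ))) (ℚ.neg-antimono-≤ (χτ≤1 x Px))

      -δτ₀ : Pt d
      -δτ₀ j = - δ (τ zero) j

      ⟪-δτ₀,-χτ⟫≡1 : ⟪ -δτ₀ , -χτ ⟫ ≡ 1ℚ
      ⟪-δτ₀,-χτ⟫≡1 = begin
        ⟪ -δτ₀ , -χτ ⟫                       ≡⟨ ⟪⟫-negʳ -δτ₀ (χ τ) ⟩
        - ⟪ -δτ₀ , χ τ ⟫                     ≡⟨ cong -_ (trans (⟪⟫-comm -δτ₀ (χ τ)) (⟪⟫-negʳ (χ τ) (δ (τ zero)))) ⟩
        - - ⟪ χ τ , δ (τ zero) ⟫             ≡⟨ neg-involutive ⟪ χ τ , δ (τ zero) ⟫ ⟩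
        ⟪ χ τ , δ (τ zero) ⟫                 ≡⟨ ⟪⟫-δʳ (χ τ) (τ zero) ⟩
        χ τ (τ zero)                         ≡⟨ χ-image τ-injective zero ⟩
        1ℚ                                   ∎
        where open ≡-Reasoning

      gap : K * - 1ℚ ℚ.< ⟪ A , -χτ ⟫
      gap = valid⇒Kb<⟪A,a⟫ -χτ -δτ₀ (- 1ℚ) ⟪-δτ₀,-χτ⟫≡1 -χτ≥-1

    χ-valid⇒sum<K : sum (λ i → A (τ i)) ℚ.< K
    χ-valid⇒sum<K = subst₂ ℚ._<_ (neg-involutive σ) (neg-involutive K) (ℚ.neg-antimono-< (subst₂ ℚ._<_ -K≡ -σ≡ gap))
      where
      -K≡ : K * - 1ℚ ≡ - K
      -K≡ = solve 1 (λ K → K :* con (- 1ℚ) := :- K) refl K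
      -σ≡ : ⟪ A , -χτ ⟫ ≡ - σ
      -σ≡ = trans (⟪⟫-negʳ A (χ τ)) (cong -_ (⟪⟫-χʳ A τ))

    K≤sum+1 : 0 ℕ.< k → (∀ i → P (δ (τ i))) → (∀ f → (∀ i → τ i ≢ f) → ∃ λ i → P (λ j → δ f j + δ (τ i) j)) →
            K ℚ.≤ sum (λ i → A (τ i)) + 1ℚ
    K≤sum+1 k>0 Pδτ partner = p-q≤r⇒p≤q+r (*ℤ→ℚ≡-1⇒≤1 (z (τ zero)) (ℚ.<⇒≤ (p<q⇒0<q-p χ-valid⇒sum<K)) [K-σ]t≡-1)
      where
      z : Fin d → ℤ
      z = proj₁ (valid⇒latticeNormal -χτ (- 1ℚ) -χτ≥-1 gap)
      Z : Pt d
      Z j = ℤ→ℚ (z j)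
      t : ℚ
      t = Z (τ zero)
      onFace : ∀ x → P x → ⟪ x , χ τ ⟫ ≡ 1ℚ → height x Z ≡ - 1ℚ
      onFace x Px ⟪x,χτ⟫≡1 =
        proj₂ (valid⇒latticeNormal -χτ (- 1ℚ) -χτ≥-1 gap) x Px (trans (⟪⟫-negʳ x (χ τ)) (cong -_ ⟪x,χτ⟫≡1))
      onFace-δτ₀ : height (δ (τ zero)) Z ≡ - 1ℚ
      onFace-δτ₀ = onFace (δ (τ zero)) (Pδτ zero) (trans (⟪⟫-δˡ (τ zero) (χ τ)) (χ-image τ-injective zero))
      Z≗tχτ : ∀ e → Z e ≡ t * χ τ e
      Z≗tχτ = faceNormal≗multipleOfχ k>0 τ-injective Pδτ partner Z onFace
      [K-σ]t≡-1 : (K - σ) * t ≡ - 1ℚ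
      [K-σ]t≡-1 = begin
        (K - σ) * t                       ≡⟨ solve 3 (λ K σ t → (K :- σ) :* t := K :* t :- t :* σ) refl K σ t ⟩
        K * t - t * σ                     ≡⟨ cong₂ (λ u v → K * u - v) (⟪⟫-δˡ (τ zero) Z) ⟪A,Z⟫≡tσ ⟨
        height (δ (τ zero)) Z             ≡⟨ onFace-δτ₀ ⟩
        - 1ℚ                              ∎
        where
        open ≡-Reasoning
        ⟪A,Z⟫≡tσ : ⟪ A , Z ⟫ ≡ t * σ
        ⟪A,Z⟫≡tσ = trans (⟪⟫-congʳ A Z≗tχτ) (trans (⟪⟫-scaleʳ t A (χ τ)) (cong (t *_) (⟪⟫-χʳ A τ)))

Incident : {V : Set} → V → V × V → Set
Incident u (a , b) = u ≡ a ⊎ u ≡ b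

Incident⇒ShareVertex : {V : Set} {u : V} (p q : V × V) → Incident u p → Incident u q → ShareVertex p q
Incident⇒ShareVertex (a , b) (c , d) (inj₁ u≡a) (inj₁ u≡c) = inj₁ (trans (sym u≡a) u≡c)
Incident⇒ShareVertex (a , b) (c , d) (inj₁ u≡a) (inj₂ u≡d) = inj₂ (inj₁ (trans (sym u≡a) u≡d))
Incident⇒ShareVertex (a , b) (c , d) (inj₂ u≡b) (inj₁ u≡c) = inj₂ (inj₂ (inj₁ (trans (sym u≡b) u≡c)))
Incident⇒ShareVertex (a , b) (c , d) (inj₂ u≡b) (inj₂ u≡d) = inj₂ (inj₂ (inj₂ (trans (sym u≡b) u≡d)))

ShareVertex-sym : {V : Set} (p q : V × V) → ShareVertex p q → ShareVertex q p
ShareVertex-sym (a , b) (c , d) (inj₁ a≡c) = inj₁ (sym a≡c)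
ShareVertex-sym (a , b) (c , d) (inj₂ (inj₁ a≡d)) = inj₂ (inj₂ (inj₁ (sym a≡d)))
ShareVertex-sym (a , b) (c , d) (inj₂ (inj₂ (inj₁ b≡c))) = inj₂ (inj₁ (sym b≡c))
ShareVertex-sym (a , b) (c , d) (inj₂ (inj₂ (inj₂ b≡d))) = inj₂ (inj₂ (inj₂ (sym b≡d)))

module Matchings {V : Set} {E : ℕ} (ends : Fin E → V × V) where

  MatchingPoints : Region E
  MatchingPoints x = Σ (Fin E → Bool) λ M → IsMatching ends M × (∀ e → x e ≡ indicator M e)

  ⁅⁆-isMatching : (f : Fin E) → IsMatching ends ⁅ f ⁆
  ⁅⁆-isMatching f e e′ e≢e′ e∈ e′∈ = ⊥-elim (e≢e′ (trans (⁅⁆-true e∈) (sym (⁅⁆-true e′∈))))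

  ⁅⁆∪⁅⁆-isMatching : {f g : Fin E} → ¬ ShareVertex (ends f) (ends g) → IsMatching ends (⁅ f ⁆ ∪ ⁅ g ⁆)
  ⁅⁆∪⁅⁆-isMatching {f} {g} disjoint e e′ e≢e′ e∈ e′∈
    with ⁅⁆∪⁅⁆-true {f = f} {g} {e} e∈ | ⁅⁆∪⁅⁆-true {f = f} {g} {e′} e′∈
  ... | inj₁ refl | inj₁ refl = ⊥-elim (e≢e′ refl)
  ... | inj₁ refl | inj₂ refl = disjoint
  ... | inj₂ refl | inj₁ refl = disjoint ∘ ShareVertex-sym (ends g) (ends f)
  ... | inj₂ refl | inj₂ refl = ⊥-elim (e≢e′ refl)

  PM-indicator : {M : Fin E → Bool} → IsMatching ends M → MatchingPolytope ends (indicator M)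
  PM-indicator {M} isMatching = Conv-singleton {S = MatchingPoints} (M , isMatching , λ _ → refl)

  PM-origin : MatchingPolytope ends (λ _ → 0ℚ)
  PM-origin = PM-indicator {λ _ → false} (λ _ _ _ ())

  PM-δ : (f : Fin E) → MatchingPolytope ends (δ f)
  PM-δ f = PM-indicator (⁅⁆-isMatching f)

  PM-pair : {f g : Fin E} → f ≢ g → ¬ ShareVertex (ends f) (ends g) → MatchingPolytope ends (λ j → δ f j + δ g j)
  PM-pair f≢g disjoint =
    Conv-singleton {S = MatchingPoints} (_ , ⁅⁆∪⁅⁆-isMatching disjoint , λ j → sym (indicator⁅⁆∪⁅⁆ f≢g j))

  PM-nonNeg : ∀ x → MatchingPolytope ends x → ∀ e → 0ℚ ℚ.≤ x e
  PM-nonNeg x PMx e = subst (0ℚ ℚ.≤_) (⟪⟫-δˡ e x) (Conv-≥ (δ e) 0ℚ vertex≥0 PMx)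
    where
    vertex≥0 : ∀ s → MatchingPoints s → 0ℚ ℚ.≤ ⟪ δ e , s ⟫
    vertex≥0 s (M , _ , s≡) with M e | s≡ e
    ... | true  | sₑ≡1 = subst (0ℚ ℚ.≤_) (sym (trans (⟪⟫-δˡ e s) sₑ≡1)) (ℚ.nonNegative⁻¹ 1ℚ)
    ... | false | sₑ≡0 = ℚ.≤-reflexive (sym (trans (⟪⟫-δˡ e s) sₑ≡0))

  PM-star : {c : ℕ} {τ : Fin c → Fin E} (u : V) → Injective _≡_ _≡_ τ → (∀ i → Incident u (ends (τ i))) →
            ∀ x → MatchingPolytope ends x → ⟪ x , χ τ ⟫ ℚ.≤ 1ℚ
  PM-star {τ = τ} u τ-injective τ∋u x PMx = subst (ℚ._≤ 1ℚ) (⟪⟫-comm (χ τ) x) (Conv-≤ (χ τ) 1ℚ vertex≤1 PMx)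
    where
    vertex≤1 : ∀ s → MatchingPoints s → ⟪ χ τ , s ⟫ ℚ.≤ 1ℚ
    vertex≤1 s (M , isMatching , s≡) = begin
      ⟪ χ τ , s ⟫               ≡⟨ ⟪⟫-comm (χ τ) s ⟩
      ⟪ s , χ τ ⟫               ≡⟨ ⟪⟫-χʳ s τ ⟩
      sum (λ i → s (τ i))       ≡⟨ sum-cong-≗ (s≡ ∘ τ) ⟩
      sum (indicator (M ∘ τ))   ≤⟨ sum-indicator≤1 (M ∘ τ) (λ i i′ i≢i′ Mτᵢ Mτᵢ′ →
                                     isMatching (τ i) (τ i′) (i≢i′ ∘ τ-injective) Mτᵢ Mτᵢ′
                                       (Incident⇒ShareVertex (ends (τ i)) (ends (τ i′)) (τ∋u i) (τ∋u i′))) ⟩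
      1ℚ                        ∎
      where open ℚ.≤-Reasoning

cyc-fromℕ : (m : ℕ) → cyc (fromℕ m) ≡ zero
cyc-fromℕ m with suc (toℕ (fromℕ m)) ℕ.<? suc m
... | yes m+1<m+1 = ⊥-elim (ℕ.<-irrefl (cong suc (Fin.toℕ-fromℕ m)) m+1<m+1)
... | no _ = refl

cyc≡zero⇒fromℕ : (m : ℕ) (i : Fin (suc m)) → cyc i ≡ zero → i ≡ fromℕ m
cyc≡zero⇒fromℕ m i with suc (toℕ i) ℕ.<? suc m
... | yes _ = λ ()
... | no i+1≮m+1 = λ _ → Fin.toℕ-injective (begin
  toℕ i            ≡⟨ ℕ.≤-antisym (ℕ.≤-pred (Fin.toℕ<n i)) (ℕ.≮⇒≥ (i+1≮m+1 ∘ ℕ.s≤s)) ⟩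
  m                ≡⟨ Fin.toℕ-fromℕ m ⟨
  toℕ (fromℕ m)    ∎)
  where open ≡-Reasoning

module Wheel (j : ℕ) where

  m : ℕ
  m = suc (suc (suc j))

  ends : Fin (m ℕ.+ m) → WheelV (suc m) × WheelV (suc m)
  ends = wheelEnds (suc m)

  hub : WheelV (suc m)
  hub = inj₂ tt

  last : Fin m
  last = fromℕ (suc (suc j))

  rim spoke : Fin m → Fin (m ℕ.+ m)
  rim i = i ↑ˡ m
  spoke i = m ↑ʳ i

  ends-rim : ∀ i → ends (rim i) ≡ (inj₁ i , inj₁ (cyc i))
  ends-rim i rewrite Fin.splitAt-↑ˡ m i m = refl

  ends-spoke : ∀ i → ends (spoke i) ≡ (inj₁ i , hub)
  ends-spoke i rewrite Fin.splitAt-↑ʳ m m i = refl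

  rim-or-spoke : ∀ f → (∃ λ i → rim i ≡ f) ⊎ (∃ λ i → spoke i ≡ f)
  rim-or-spoke f with splitAt m f in splitAt≡
  ... | inj₁ i = inj₁ (i , Fin.splitAt⁻¹-↑ˡ splitAt≡)
  ... | inj₂ i = inj₂ (i , Fin.splitAt⁻¹-↑ʳ splitAt≡)

  rim≢spoke : ∀ i i′ → rim i ≢ spoke i′
  rim≢spoke i i′ rim≡spoke with trans (sym (Fin.splitAt-↑ˡ m i m)) (trans (cong (splitAt m) rim≡spoke) (Fin.splitAt-↑ʳ m m i′))
  ... | ()

  spoke-injective : Injective _≡_ _≡_ spoke
  spoke-injective = Fin.↑ʳ-injective m _ _

  spoke-incident : ∀ i → Incident hub (ends (spoke i))
  spoke-incident i rewrite ends-spoke i = inj₂ refl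

  star₀ : Fin 3 → Fin (m ℕ.+ m)
  star₀ zero = rim zero
  star₀ (suc zero) = rim last
  star₀ (suc (suc zero)) = spoke zero

  star₀-injective : Injective _≡_ _≡_ star₀
  star₀-injective {zero}             {zero}             _ = refl
  star₀-injective {zero}             {suc zero}         e with Fin.↑ˡ-injective m zero last e
  ... | ()
  star₀-injective {zero}             {suc (suc zero)}   e = ⊥-elim (rim≢spoke zero zero e)
  star₀-injective {suc zero}         {zero}             e with Fin.↑ˡ-injective m last zero e
  ... | ()
  star₀-injective {suc zero}         {suc zero}         _ = refl
  star₀-injective {suc zero}         {suc (suc zero)}   e = ⊥-elim (rim≢spoke last zero e)
  star₀-injective {suc (suc zero)}   {zero}             e = ⊥-elim (rim≢spoke zero zero (sym e))
  star₀-injective {suc (suc zero)}   {suc zero}         e = ⊥-elim (rim≢spoke last zero (sym e))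
  star₀-injective {suc (suc zero)}   {suc (suc zero)}   _ = refl

  star₀-incident : ∀ i → Incident (inj₁ zero) (ends (star₀ i))
  star₀-incident zero rewrite ends-rim zero = inj₁ refl
  star₀-incident (suc zero) rewrite ends-rim last | cyc-fromℕ (suc (suc j)) = inj₂ refl
  star₀-incident (suc (suc zero)) rewrite ends-spoke zero = inj₁ refl

  rim-disjoint-spoke₀ : ∀ i → i ≢ zero → i ≢ last → ¬ ShareVertex (ends (rim i)) (ends (spoke zero))
  rim-disjoint-spoke₀ i i≢0 i≢last rewrite ends-rim i | ends-spoke zero = λ
    { (inj₁ i≡0) → i≢0 (inj₁-injective i≡0)
    ; (inj₂ (inj₁ ()))
    ; (inj₂ (inj₂ (inj₁ cycᵢ≡0))) → i≢last (cyc≡zero⇒fromℕ (suc (suc j)) i (inj₁-injective cycᵢ≡0))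
    ; (inj₂ (inj₂ (inj₂ ()))) }

  spoke-partner : ∀ i → i ≢ zero → ∃ λ c → ¬ ShareVertex (ends (spoke i)) (ends (star₀ c))
  spoke-partner zero i≢0 = ⊥-elim (i≢0 refl)
  spoke-partner (suc zero) _ = suc zero , disjoint
    where
    disjoint : ¬ ShareVertex (ends (spoke (suc zero))) (ends (rim last))
    disjoint rewrite ends-spoke (suc zero) | ends-rim last | cyc-fromℕ (suc (suc j)) = λ
      { (inj₁ ()) ; (inj₂ (inj₁ ())) ; (inj₂ (inj₂ (inj₁ ()))) ; (inj₂ (inj₂ (inj₂ ()))) }
  spoke-partner (suc (suc i)) _ = zero , disjoint
    where
    disjoint : ¬ ShareVertex (ends (spoke (suc (suc i)))) (ends (rim zero))
    disjoint rewrite ends-spoke (suc (suc i)) | ends-rim zero = λ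
      { (inj₁ ()) ; (inj₂ (inj₁ ())) ; (inj₂ (inj₂ (inj₁ ()))) ; (inj₂ (inj₂ (inj₂ ()))) }

  star₀-partner : ∀ f → (∀ c → star₀ c ≢ f) → ∃ λ c → f ≢ star₀ c × ¬ ShareVertex (ends f) (ends (star₀ c))
  star₀-partner f f∉star₀ with rim-or-spoke f
  ... | inj₁ (i , refl) = suc (suc zero) , f∉star₀ (suc (suc zero)) ∘ sym ,
                          rim-disjoint-spoke₀ i (f∉star₀ zero ∘ cong rim ∘ sym) (f∉star₀ (suc zero) ∘ cong rim ∘ sym)
  ... | inj₂ (i , refl) = let c , disjoint = spoke-partner i (f∉star₀ (suc (suc zero)) ∘ cong spoke ∘ sym) in
                          c , f∉star₀ c ∘ sym , disjoint

proposition4p1 : (n : ℕ) → 5 ≤ n → ¬ IsGorenstein (MatchingPolytope (wheelEnds n))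
proposition4p1 _ (ℕ.s≤s (ℕ.s≤s (ℕ.s≤s (ℕ.s≤s (ℕ.s≤s {n = j} ℕ.z≤n))))) (k , k>0 , α , _ , polar-lattice) =
  ℚ.<-irrefl refl (begin-strict
    K                                  ≤⟨ star₀-bound ⟩
    sum (λ i → A (star₀ i)) + 1ℚ      ≡⟨ cong (_+ 1ℚ) (sum-cong-≗ (A≡1 ∘ star₀)) ⟩
    sum {3} (λ _ → 1ℚ) + 1ℚ            ≡⟨⟩
    1ℚ + (1ℚ + (1ℚ + (1ℚ + 0ℚ)))       ≤⟨ 4≤m ⟩
    sum {m} (λ _ → 1ℚ)                 ≡⟨ sum-cong-≗ (A≡1 ∘ spoke) ⟨
    sum (λ i → A (spoke i))            <⟨ hub-gap ⟩
    K                                  ∎)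
  where
  open ℚ.≤-Reasoning
  open Wheel (suc j)
  open Matchings ends
  open DilatedPolar (MatchingPolytope ends) k α polar-lattice
  A≡1 : ∀ e → A e ≡ 1ℚ
  A≡1 = α≡1 k>0 PM-origin PM-δ PM-nonNeg
  hub-gap : sum (λ i → A (spoke i)) ℚ.< K
  hub-gap = χ-valid⇒sum<K spoke-injective (PM-star hub spoke-injective spoke-incident)
  star₀-bound : K ℚ.≤ sum (λ i → A (star₀ i)) + 1ℚ
  star₀-bound = K≤sum+1 star₀-injective (PM-star (inj₁ zero) star₀-injective star₀-incident) k>0 (PM-δ ∘ star₀)
    λ f f∉star₀ → let c , f≢c , disjoint = star₀-partner f f∉star₀ in c , PM-pair f≢c disjoint
  4≤m : 1ℚ + (1ℚ + (1ℚ + (1ℚ + 0ℚ))) ℚ.≤ sum {m} (λ _ → 1ℚ)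
  4≤m = ℚ.+-monoʳ-≤ 1ℚ (ℚ.+-monoʳ-≤ 1ℚ (ℚ.+-monoʳ-≤ 1ℚ (ℚ.+-monoʳ-≤ 1ℚ
          (sum-nonNeg {j} (λ _ → ℚ.nonNegative⁻¹ 1ℚ)))))
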